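{- For path graph $\mathbb{P}_n,n\neq4,7$ and for $k=0,1,2,3,...$ $$TDI(\mathbb{P}_n)=\begin{cases} 4(2k+1)(k+1) &\text{ if } n=4k+2,k\geq0\\ 8k^2+7k+2 & \text{ if } n=4k+1,k>0\\ 8k^2+15k+6 & \text{ if } n=4k+3,k=0,k>1\\ 2k(4k+1) & \text{ if } n=4k,k>1 \end{cases}$$
   Context: A total dominating set (TDS) is a vertex set $S$ such that every vertex is adjacent to a vertex of $S$; a minimal TDS (MTDS) has no proper subset that is a TDS. A vertex is compliant if some MTDS contains it; a graph is compliant if all its vertices are (paths $\mathbb{P}_n$, $n\ne 4,7$, are compliant). For a vertex $a$ of a compliant graph, $d_{td}(a)=\min\{|S| : S \text{ an MTDS containing } a\}$, and the total domination index is $TDI(\mathbb{G})=\sum_{a\in V(\mathbb{G})} d_{td}(a)$. -}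

module Defs where

open import Data.Nat using (ℕ; zero; suc; _+_; _*_; _≤_)
open import Data.Fin using (Fin; toℕ)
open import Data.Fin.Subset using (Subset; _∈_; _⊂_; ∣_∣)
open import Data.Product using (Σ; ∃; _×_)
open import Data.Sum using (_⊎_)
open import Data.List using (map; allFin)
open import Data.Nat.ListAction using (sum)
open import Relation.Nullary using (¬_)
open import Relation.Binary.PropositionalEquality using (_≡_)

PathAdj : {n : ℕ} → Fin n → Fin n → Set
PathAdj i j = (toℕ j ≡ suc (toℕ i)) ⊎ (toℕ i ≡ suc (toℕ j))

IsTDS : (n : ℕ) → Subset n → Set
IsTDS n S = (v : Fin n) → ∃ λ u → u ∈ S × PathAdj v u

IsMTDS : (n : ℕ) → Subset n → Set
IsMTDS n S = IsTDS n S × ((T : Subset n) → T ⊂ S → ¬ IsTDS n T)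

-- d is d_td(a): the minimum cardinality of an MTDS containing a
-- (this presupposes that a is compliant).
IsDtd : (n : ℕ) → Fin n → ℕ → Set
IsDtd n a d =
  (Σ (Subset n) λ S → IsMTDS n S × a ∈ S × ∣ S ∣ ≡ d)
  × ((S : Subset n) → IsMTDS n S → a ∈ S → d ≤ ∣ S ∣)

-- t is TDI(P_n): P_n is compliant and t = Σ_a d_td(a).
IsTDI : (n : ℕ) → ℕ → Set
IsTDI n t = Σ (Fin n → ℕ) λ d → ((a : Fin n) → IsDtd n a (d a))
                                 × sum (map d (allFin n)) ≡ t

{-# OPTIONS --safe #-}
-- Subsets of P_n are bit strings.  For the upper bound, a minimal TDS through a of size
-- 2k + E(a mod 4) is (0110)^i w (0110)^j with a short middle word w chosen by the residue of a.
-- It is minimal because every member has a private neighbour, which (with total domination) a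
-- finite automaton reading the string from the right recognises; prepending 0110 preserves
-- acceptance and every nonempty run of blocks ends in the same state, so only w needs checking.
-- For the lower bound, a string S of length m in which every vertex but the first is dominated
-- satisfies m + ψ ≤ 2|S| + 1 for a potential ψ depending on m mod 4, the first two letters and
-- the residue of a prescribed member; prepending a letter preserves this by finitely many
-- inequalities.  Summing 2k + E(a mod 4) over the residues gives the four formulas.
module Submission where

open import Defs
open import Data.Bool using (Bool; true; false; _∧_; _∨_; not; T)
open import Data.Bool.Properties using (T-∧; T-∨; T-≡; ∨-identityʳ; ∧-inverseʳ)
open import Data.Empty using (⊥-elim)
open import Data.Fin using (Fin; zero; suc; toℕ; fromℕ<)
open import Data.Fin.Properties using (toℕ-injective; toℕ<n; toℕ-fromℕ<; all?)
open import Data.Fin.Subset using (Subset; _∈_; _⊂_; ∣_∣)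
open import Data.List as List using (map; allFin; tabulate; applyUpTo)
open import Data.List.Properties using (map-tabulate)
open import Data.Nat using (ℕ; zero; suc; _+_; _*_; _∸_; _<_; _≤_; _<ᵇ_; z≤n; s≤s; _≟_; _≤?_)
open import Data.Nat.ListAction using (sum)
open import Data.Nat.Properties
  using (suc-injective; ≤-reflexive; ≤-trans; <-trans; n<1+n; m<1+n⇒m≤n; <ᵇ⇒<; m∸n+n≡m;
         +-suc; +-assoc; +-comm; *-distribˡ-+; +-monoʳ-≤; +-monoˡ-≤; *-cancelˡ-<; module ≤-Reasoning)
open import Data.Nat.Tactic.RingSolver using (solve-∀)
open import Data.Product using (Σ; ∃; ∃₂; _×_; _,_; proj₁)
open import Data.Sum using (inj₁; inj₂)
open import Data.Vec.Base using ([]; _∷_; _++_; here; there)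
open import Function using (_∘_; id)
open import Function.Bundles using (Equivalence)
open import Relation.Binary.PropositionalEquality using (_≡_; _≢_; refl; sym; trans; cong; subst; subst₂)
open import Relation.Nullary using (Dec; ¬_; contradiction)
open import Relation.Nullary.Decidable using (map′; _×-dec_; _→-dec_; T?; from-yes)

data Mod4 : Set where
  0₄ 1₄ 2₄ 3₄ : Mod4

next : Mod4 → Mod4
next 0₄ = 1₄
next 1₄ = 2₄
next 2₄ = 3₄
next 3₄ = 0₄

mod4 : ℕ → Mod4
mod4 0 = 0₄
mod4 1 = 1₄
mod4 2 = 2₄
mod4 3 = 3₄
mod4 (suc (suc (suc (suc n)))) = mod4 n

mod4-suc : ∀ n → mod4 (suc n) ≡ next (mod4 n)
mod4-suc 0 = refl
mod4-suc 1 = refl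
mod4-suc 2 = refl
mod4-suc 3 = refl
mod4-suc (suc (suc (suc (suc n)))) = mod4-suc n

mod4-*4+ : ∀ k r → mod4 (k * 4 + r) ≡ mod4 r
mod4-*4+ zero r = refl
mod4-*4+ (suc k) r = mod4-*4+ k r

∀-Bool? : {P : Bool → Set} → (∀ b → Dec (P b)) → Dec (∀ b → P b)
∀-Bool? P? = map′ (λ (p₀ , p₁) → λ { false → p₀ ; true → p₁ }) (λ p → p false , p true)
                  (P? false ×-dec P? true)

∀-Mod4? : {P : Mod4 → Set} → (∀ r → Dec (P r)) → Dec (∀ r → P r)
∀-Mod4? P? = map′ (λ (p₀ , p₁ , p₂ , p₃) → λ { 0₄ → p₀ ; 1₄ → p₁ ; 2₄ → p₂ ; 3₄ → p₃ })
                  (λ p → p 0₄ , p 1₄ , p 2₄ , p 3₄)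
                  (P? 0₄ ×-dec P? 1₄ ×-dec P? 2₄ ×-dec P? 3₄)

T-not⇒¬T : ∀ {b} → T (not b) → ¬ T b
T-not⇒¬T {false} _ ()

bit : Bool → ℕ
bit false = 0
bit true = 1

∣∷∣ : ∀ {n} b (S : Subset n) → ∣ b ∷ S ∣ ≡ bit b + ∣ S ∣
∣∷∣ false S = refl
∣∷∣ true S = refl

∣++∣ : ∀ {m n} (X : Subset m) (Y : Subset n) → ∣ X ++ Y ∣ ≡ ∣ X ∣ + ∣ Y ∣
∣++∣ [] Y = refl
∣++∣ (false ∷ X) Y = ∣++∣ X Y
∣++∣ (true ∷ X) Y = cong suc (∣++∣ X Y)

-- Vertices beyond the end count as non-members.
_‼_ : ∀ {n} → Subset n → ℕ → Bool
[] ‼ i = false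
(b ∷ S) ‼ zero = b
(b ∷ S) ‼ suc i = S ‼ i

_‼←_ : ∀ {n} → Subset n → ℕ → Bool
S ‼← zero = false
S ‼← suc i = S ‼ i

‼-++ˡ : ∀ {m n} (X : Subset m) (Y : Subset n) {i} → i < m → (X ++ Y) ‼ i ≡ X ‼ i
‼-++ˡ (b ∷ X) Y {zero} _ = refl
‼-++ˡ (b ∷ X) Y {suc i} (s≤s i<m) = ‼-++ˡ X Y i<m

‼-++ʳ : ∀ {m n} (X : Subset m) (Y : Subset n) i → (X ++ Y) ‼ (m + i) ≡ Y ‼ i
‼-++ʳ [] Y i = refl
‼-++ʳ (b ∷ X) Y i = ‼-++ʳ X Y i

∈⇒‼ : ∀ {n} {S : Subset n} {u} → u ∈ S → T (S ‼ toℕ u)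
∈⇒‼ here = _
∈⇒‼ (there u∈S) = ∈⇒‼ u∈S

‼⇒∈ : ∀ {n} (S : Subset n) i → T (S ‼ i) → ∃ λ u → toℕ u ≡ i × u ∈ S
‼⇒∈ (true ∷ S) zero _ = zero , refl , here
‼⇒∈ (b ∷ S) (suc i) h with ‼⇒∈ S i h
... | u , refl , u∈S = suc u , refl , there u∈S

‼←⇒∈ : ∀ {n} (S : Subset n) i → T (S ‼← i) → ∃ λ u → i ≡ suc (toℕ u) × u ∈ S
‼←⇒∈ S (suc i) h with ‼⇒∈ S i h
... | u , refl , u∈S = u , refl , u∈S

‼toℕ⇒∈ : ∀ {n} (S : Subset n) a → T (S ‼ toℕ a) → a ∈ S
‼toℕ⇒∈ S a h with ‼⇒∈ S (toℕ a) h
... | u , u≡a , u∈S = subst (_∈ S) (toℕ-injective u≡a) u∈S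

dominated : ∀ {n} → Subset n → ℕ → Bool
dominated S v = S ‼ suc v ∨ S ‼← v

-- i - 1 (resp. i + 1) is a private neighbour of i: it exists and its other neighbour is not in S.
leftPrivate : ∀ {n} → Subset n → ℕ → Bool
leftPrivate S zero = false
leftPrivate S (suc i) = not (S ‼← i)

rightPrivate : ∀ {n} → Subset n → ℕ → Bool
rightPrivate {n} S i = (suc i <ᵇ n) ∧ not (S ‼ suc (suc i))

hasPrivateNeighbour : ∀ {n} → Subset n → ℕ → Bool
hasPrivateNeighbour S i = leftPrivate S i ∨ rightPrivate S i

TotallyDominating : ∀ {n} → Subset n → Set
TotallyDominating {n} S = ∀ v → v < n → T (dominated S v)

DominatesAllButFirst : ∀ {n} → Subset n → Set
DominatesAllButFirst {n} S = ∀ v → suc v < n → T (dominated S (suc v))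

HasPrivateNeighbours : ∀ {n} → Subset n → Set
HasPrivateNeighbours S = ∀ i → T (S ‼ i) → T (hasPrivateNeighbour S i)

adjacent-member⇒dominated : ∀ {n} (S : Subset n) v {u} → u ∈ S → PathAdj v u → T (dominated S (toℕ v))
adjacent-member⇒dominated S v u∈S (inj₁ u≡v+1) =
  Equivalence.from T-∨ (inj₁ (subst (T ∘ (S ‼_)) u≡v+1 (∈⇒‼ u∈S)))
adjacent-member⇒dominated S v u∈S (inj₂ v≡u+1) =
  Equivalence.from T-∨ (inj₂ (subst (T ∘ (S ‼←_)) (sym v≡u+1) (∈⇒‼ u∈S)))

isTDS⇒dominating : ∀ {n} (S : Subset n) → IsTDS n S → TotallyDominating S
isTDS⇒dominating S tds v v<n =
  let u , u∈S , adj = tds (fromℕ< v<n)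
  in subst (T ∘ dominated S) (toℕ-fromℕ< v<n) (adjacent-member⇒dominated S _ u∈S adj)

dominating⇒isTDS : ∀ {n} (S : Subset n) → TotallyDominating S → IsTDS n S
dominating⇒isTDS S dom v with Equivalence.to T-∨ (dom (toℕ v) (toℕ<n v))
... | inj₁ right = let u , u≡v+1 , u∈S = ‼⇒∈ S _ right in u , u∈S , inj₁ u≡v+1
... | inj₂ left = let u , v≡u+1 , u∈S = ‼←⇒∈ S _ left in u , u∈S , inj₂ v≡u+1

OnlyNeighbourIn : ∀ {n} → Subset n → Fin n → Fin n → Set
OnlyNeighbourIn S x v = ∀ {u} → u ∈ S → PathAdj v u → u ≡ x

onlyNeighbour⇒minimal : ∀ {n} (S : Subset n) → (∀ {x} → x ∈ S → ∃ (OnlyNeighbourIn S x))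
                       → ∀ S′ → S′ ⊂ S → ¬ IsTDS n S′
onlyNeighbour⇒minimal S private-nbr S′ (S′⊆S , x , x∈S , x∉S′) tds =
  let v , only-x = private-nbr x∈S
      u , u∈S′ , adj = tds v
  in x∉S′ (subst (_∈ S′) (only-x (S′⊆S u∈S′) adj) u∈S′)

leftPrivate⇒onlyNeighbour : ∀ {n} (S : Subset n) x → T (leftPrivate S (toℕ x)) → ∃ (OnlyNeighbourIn S x)
leftPrivate⇒onlyNeighbour {n} S x = go (toℕ x) refl
  where
  go : ∀ i → toℕ x ≡ i → T (leftPrivate S i) → ∃ (OnlyNeighbourIn S x)
  go (suc i) x≡i+1 free = fromℕ< i<n , only
    where
    i<n : i < n
    i<n = <-trans (n<1+n i) (subst (_< n) x≡i+1 (toℕ<n x))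
    only : OnlyNeighbourIn S x (fromℕ< i<n)
    only u∈S (inj₁ u≡v+1) = toℕ-injective (trans u≡v+1 (trans (cong suc (toℕ-fromℕ< i<n)) (sym x≡i+1)))
    only u∈S (inj₂ v≡u+1) =
      contradiction (subst (T ∘ (S ‼←_)) (trans (sym v≡u+1) (toℕ-fromℕ< i<n)) (∈⇒‼ u∈S))
                    (T-not⇒¬T free)

rightPrivate⇒onlyNeighbour : ∀ {n} (S : Subset n) x → T (rightPrivate S (toℕ x)) → ∃ (OnlyNeighbourIn S x)
rightPrivate⇒onlyNeighbour {n} S x h with Equivalence.to T-∧ h
... | exists , free = fromℕ< x+1<n , only
  where
  x+1<n : suc (toℕ x) < n
  x+1<n = <ᵇ⇒< _ _ exists
  v≡x+1 : toℕ (fromℕ< x+1<n) ≡ suc (toℕ x)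
  v≡x+1 = toℕ-fromℕ< x+1<n
  only : OnlyNeighbourIn S x (fromℕ< x+1<n)
  only u∈S (inj₁ u≡v+1) =
    contradiction (subst (T ∘ (S ‼_)) (trans u≡v+1 (cong suc v≡x+1)) (∈⇒‼ u∈S)) (T-not⇒¬T free)
  only u∈S (inj₂ v≡u+1) = toℕ-injective (suc-injective (trans (sym v≡u+1) v≡x+1))

privateNeighbours⇒MTDS : ∀ {n} (S : Subset n) → TotallyDominating S → HasPrivateNeighbours S → IsMTDS n S
privateNeighbours⇒MTDS S dom priv = dominating⇒isTDS S dom , onlyNeighbour⇒minimal S private-nbr
  where
  private-nbr : ∀ {x} → x ∈ S → ∃ (OnlyNeighbourIn S x)
  private-nbr {x} x∈S with Equivalence.to T-∨ (priv (toℕ x) (∈⇒‼ x∈S))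
  ... | inj₁ left = leftPrivate⇒onlyNeighbour S x left
  ... | inj₂ right = rightPrivate⇒onlyNeighbour S x right

-- A word is read from right to left.  After reading a nonempty word S the state records its
-- first two letters p, q; whether the first (second) letter is a member with no right private
-- neighbour, so that its left neighbour has to be private (p←, q←); and whether so far every
-- vertex but the first is dominated and every member from position 2 on has a private neighbour.
data State : Set where
  empty : State
  state : (p q p← q← ok : Bool) → State

step : Bool → State → State
step b empty = state b false b false true
step b (state p q p← q← ok) = state b p (b ∧ q) p← (ok ∧ (q ∨ b) ∧ not (q← ∧ b))

accepting : State → Bool
accepting empty = false
accepting (state p q p← q← ok) = ok ∧ q ∧ not p←

runFrom : ∀ {n} → Subset n → State → State
runFrom [] σ = σ
runFrom (b ∷ S) σ = step b (runFrom S σ)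

run : ∀ {n} → Subset n → State
run S = runFrom S empty

runFrom-++ : ∀ {m n} (X : Subset m) (Y : Subset n) σ → runFrom (X ++ Y) σ ≡ runFrom X (runFrom Y σ)
runFrom-++ [] Y σ = refl
runFrom-++ (b ∷ X) Y σ = cong (step b) (runFrom-++ X Y σ)

record Invariant {n} (S : Subset n) (p q p← q← : Bool) : Set where
  field
    first : S ‼ 0 ≡ p
    second : S ‼ 1 ≡ q
    dominatesAllButFirst : DominatesAllButFirst S
    private₂₊ : ∀ i → T (S ‼ suc (suc i)) → T (hasPrivateNeighbour S (suc (suc i)))
    firstRight : T (p ∧ not p←) → T (rightPrivate S 0)
    secondRight : T (q ∧ not q←) → T (rightPrivate S 1)

Describes : ∀ {n} → Subset n → State → Set
Describes {n} S empty = n ≡ 0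
Describes S (state p q p← q← ok) = T ok → Invariant S p q p← q←

step-describes : ∀ {n} b (S : Subset (suc n)) σ → Describes S σ → Describes (b ∷ S) (step b σ)
step-describes b S (state p q p← q← ok) sound ok′
  with Equivalence.to T-∧ ok′
... | ok-t , rest with Equivalence.to T-∧ rest
... | q∨b , ¬q←∧b = record
  { first = refl
  ; second = I.first
  ; dominatesAllButFirst = λ where
      zero _ → subst (λ x → T (x ∨ b)) (sym I.second) q∨b
      (suc v) (s≤s v<n) → I.dominatesAllButFirst v v<n
  ; private₂₊ = λ where
      zero q∈S → second-private b ¬q←∧b λ ¬q← →
        I.secondRight (Equivalence.from T-∧ (subst T I.second q∈S , ¬q←))
      (suc i) → I.private₂₊ i
  ; firstRight = λ h → subst (T ∘ not) (sym I.second) (first-free b h)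
  ; secondRight = I.firstRight
  }
  where
  module I = Invariant (sound ok-t)
  second-private : ∀ b {q← x} → T (not (q← ∧ b)) → (T (not q←) → T x) → T (not b ∨ x)
  second-private false _ _ = _
  second-private true {false} _ h = h _
  first-free : ∀ b {q} → T (b ∧ not (b ∧ q)) → T (not q)
  first-free true h = h

run-describes : ∀ {n} (S : Subset n) → Describes S (run S)
run-describes [] = refl
run-describes (b ∷ []) _ = record
  { first = refl
  ; second = refl
  ; dominatesAllButFirst = λ { _ (s≤s ()) }
  ; private₂₊ = λ _ ()
  ; firstRight = λ h → ⊥-elim (subst T (∧-inverseʳ b) h)
  ; secondRight = λ ()
  }
run-describes (b ∷ c ∷ S) = step-describes b (c ∷ S) (run (c ∷ S)) (run-describes (c ∷ S))

accepting-sound : ∀ {n} (S : Subset n) → T (accepting (run S)) → TotallyDominating S × HasPrivateNeighbours S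
accepting-sound S acc with run S | run-describes S
... | state p q p← q← ok | sound with Equivalence.to T-∧ acc
... | ok-t , rest with Equivalence.to T-∧ rest
... | q-t , ¬p← = dominating , privates
  where
  module I = Invariant (sound ok-t)
  dominating : TotallyDominating S
  dominating zero _ = Equivalence.from T-∨ (inj₁ (subst T (sym I.second) q-t))
  dominating (suc v) = I.dominatesAllButFirst v
  privates : HasPrivateNeighbours S
  privates zero p∈S = I.firstRight (Equivalence.from T-∧ (subst T I.first p∈S , ¬p←))
  privates (suc zero) _ = _
  privates (suc (suc i)) = I.private₂₊ i

accepted⇒MTDS : ∀ {n} (S : Subset n) → T (accepting (run S)) → IsMTDS n S
accepted⇒MTDS S acc = let dom , priv = accepting-sound S acc in privateNeighbours⇒MTDS S dom priv

MTDSThrough : (n : ℕ) → Fin n → ℕ → Set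
MTDSThrough n a d = Σ (Subset n) λ S → IsMTDS n S × a ∈ S × ∣ S ∣ ≡ d

accepted⇒MTDSThrough : ∀ {m n} → m ≡ n → (w : Subset m) → T (accepting (run w))
                     → (a : Fin n) → T (w ‼ toℕ a) → ∀ {d} → ∣ w ∣ ≡ d → MTDSThrough n a d
accepted⇒MTDSThrough refl w acc a a∈w size = w , accepted⇒MTDS w acc , ‼toℕ⇒∈ w a a∈w , size

○ ● : Bool
○ = false
● = true

block : Subset 4
block = ○ ∷ ● ∷ ● ∷ ○ ∷ []

blocks : ∀ i → Subset (i * 4)
blocks zero = []
blocks (suc i) = block ++ blocks i

∣blocks∣ : ∀ i → ∣ blocks i ∣ ≡ i * 2
∣blocks∣ zero = refl
∣blocks∣ (suc i) = cong (2 +_) (∣blocks∣ i)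

σ₀ : State
σ₀ = state ○ ● ○ ○ ●

run-blocks : ∀ i → run (blocks (suc i)) ≡ σ₀
run-blocks zero = refl
run-blocks (suc i) = cong (runFrom block) (run-blocks i)

block-preserves-accepting : ∀ σ → T (accepting σ) → T (accepting (runFrom block σ))
block-preserves-accepting (state false true false false true) _ = _
block-preserves-accepting (state false true false true true) _ = _
block-preserves-accepting (state true true false false true) _ = _
block-preserves-accepting (state true true false true true) _ = _

blocks-preserve-accepting : ∀ i σ → T (accepting σ) → T (accepting (runFrom (blocks i) σ))
blocks-preserve-accepting zero σ acc = acc
blocks-preserve-accepting (suc i) σ acc =
  block-preserves-accepting (runFrom (blocks i) σ) (blocks-preserve-accepting i σ acc)

-- Position a of blocks i ++ w ++ blocks j, with i + j = k, falls at position ρ of w.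
Split : ℕ → ℕ → ℕ → Set
Split L k a = ∃₂ λ i j → ∃ λ (ρ : Fin L) → i + j ≡ k × a ≡ i * 4 + toℕ ρ

split-first : ∀ {L} k a → a < L → Split L k a
split-first k a a<L = 0 , k , fromℕ< a<L , refl , sym (toℕ-fromℕ< a<L)

split : ∀ {c r} → 4 ≤ c * 4 + r → ∀ k a → a < (k + c) * 4 + r → Split (c * 4 + r) k a
split 4≤L zero a a<L = split-first 0 a a<L
split 4≤L (suc k) 0 _ = split-first (suc k) 0 (≤-trans (s≤s z≤n) 4≤L)
split 4≤L (suc k) 1 _ = split-first (suc k) 1 (≤-trans (s≤s (s≤s z≤n)) 4≤L)
split 4≤L (suc k) 2 _ = split-first (suc k) 2 (≤-trans (s≤s (s≤s (s≤s z≤n))) 4≤L)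
split 4≤L (suc k) 3 _ = split-first (suc k) 3 4≤L
split 4≤L (suc k) (suc (suc (suc (suc a)))) (s≤s (s≤s (s≤s (s≤s a<)))) with split 4≤L k a a<
... | i , j , ρ , refl , refl = suc i , j , ρ , refl , refl

GoodMiddle : ∀ {L} → ℕ → (Mod4 → ℕ) → Subset L → ℕ → Set
GoodMiddle c E w ρ =
  T (accepting (run w)) × T (accepting (runFrom w σ₀)) × T (w ‼ ρ) × ∣ w ∣ ≡ c * 2 + E (mod4 ρ)

GoodMiddles : ∀ {L} → ℕ → (Mod4 → ℕ) → (Mod4 → Subset L) → Set
GoodMiddles {L} c E middle = ∀ (ρ : Fin L) → GoodMiddle c E (middle (mod4 (toℕ ρ))) (toℕ ρ)

goodMiddles? : ∀ {L} c E (middle : Mod4 → Subset L) → Dec (GoodMiddles c E middle)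
goodMiddles? c E middle = all? λ ρ → T? _ ×-dec T? _ ×-dec T? _ ×-dec ∣ middle (mod4 (toℕ ρ)) ∣ ≟ _

pad : ∀ {L} i → Subset L → ∀ j → Subset (i * 4 + (L + j * 4))
pad i w j = blocks i ++ (w ++ blocks j)

accepting-pad : ∀ {L} (w : Subset L) → T (accepting (run w)) → T (accepting (runFrom w σ₀))
              → ∀ i j → T (accepting (run (pad i w j)))
accepting-pad w acc acc-σ₀ i j
  rewrite runFrom-++ (blocks i) (w ++ blocks j) empty | runFrom-++ w (blocks j) empty =
  blocks-preserve-accepting i _ (after-blocks j)
  where
  after-blocks : ∀ j → T (accepting (runFrom w (run (blocks j))))
  after-blocks zero = acc
  after-blocks (suc j) = subst (T ∘ accepting ∘ runFrom w) (sym (run-blocks j)) acc-σ₀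

‼-pad : ∀ {L} i (w : Subset L) j {ρ} → ρ < L → pad i w j ‼ (i * 4 + ρ) ≡ w ‼ ρ
‼-pad i w j ρ<L = trans (‼-++ʳ (blocks i) _ _) (‼-++ˡ w (blocks j) ρ<L)

∣pad∣ : ∀ {L} i (w : Subset L) j → ∣ pad i w j ∣ ≡ i * 2 + (∣ w ∣ + j * 2)
∣pad∣ i w j rewrite ∣++∣ (blocks i) (w ++ blocks j) | ∣++∣ w (blocks j) | ∣blocks∣ i | ∣blocks∣ j =
  refl

block-witnesses : ∀ {c r} (E : Mod4 → ℕ) (middle : Mod4 → Subset (c * 4 + r)) → 4 ≤ c * 4 + r
                → GoodMiddles c E middle
                → ∀ k → c ≤ k → (a : Fin (k * 4 + r)) → MTDSThrough _ a (2 * k + E (mod4 (toℕ a)))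
block-witnesses {c} {r} E middle 4≤L good k c≤k a with k ∸ c | m∸n+n≡m c≤k
... | o | refl with split 4≤L o (toℕ a) (toℕ<n a)
... | i , j , ρ , refl , a≡ with good ρ
... | accepted , accepted-σ₀ , contains-ρ , ∣m∣ =
  accepted⇒MTDSThrough (pad-length c r i j) (pad i m j) (accepting-pad m accepted accepted-σ₀ i j)
    a contains size
  where
  pad-length : ∀ c r i j → i * 4 + ((c * 4 + r) + j * 4) ≡ ((i + j) + c) * 4 + r
  pad-length = solve-∀
  pad-size : ∀ c i j e → i * 2 + ((c * 2 + e) + j * 2) ≡ 2 * ((i + j) + c) + e
  pad-size = solve-∀
  m : Subset (c * 4 + r)
  m = middle (mod4 (toℕ ρ))
  contains : T (pad i m j ‼ toℕ a)
  contains rewrite a≡ | ‼-pad i m j (toℕ<n ρ) = contains-ρ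
  size : ∣ pad i m j ∣ ≡ 2 * ((i + j) + c) + E (mod4 (toℕ a))
  size rewrite a≡ | mod4-*4+ i (toℕ ρ) | ∣pad∣ i m j | ∣m∣ = pad-size c i j _

table : (x₀₀ x₀₁ x₁₀ x₁₁ : ℕ) → Bool → Bool → ℕ
table x₀₀ x₀₁ x₁₀ x₁₁ false false = x₀₀
table x₀₀ x₀₁ x₁₀ x₁₁ false true = x₀₁
table x₀₀ x₀₁ x₁₀ x₁₁ true false = x₁₀
table x₀₀ x₀₁ x₁₀ x₁₁ true true = x₁₁

-- In ψ r p q and ψ* ra r p q, r is the length of a word mod 4, p q are its first two letters and
-- ra is the position mod 4 of a prescribed member.
ψ : Mod4 → Bool → Bool → ℕ
ψ 0₄ = table 1 1 3 3
ψ 1₄ = table 0 2 2 4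
ψ 2₄ = table 1 3 1 3
ψ 3₄ = table 2 2 2 2

ψ* : Mod4 → Mod4 → Bool → Bool → ℕ
ψ* 0₄ 0₄ = table 3 3 3 3
ψ* 0₄ 1₄ = table 2 4 2 4
ψ* 0₄ 2₄ = table 1 3 1 3
ψ* 0₄ 3₄ = table 2 2 2 2
ψ* 1₄ 0₄ = table 1 1 3 3
ψ* 1₄ 1₄ = table 2 2 4 4
ψ* 1₄ 2₄ = table 3 3 3 3
ψ* 1₄ 3₄ = table 2 2 2 2
ψ* 2₄ 0₄ = table 1 1 3 3
ψ* 2₄ 1₄ = table 0 2 2 4
ψ* 2₄ 2₄ = table 1 3 3 5
ψ* 2₄ 3₄ = table 2 2 4 4
ψ* 3₄ 0₄ = table 1 3 3 5
ψ* 3₄ 1₄ = table 0 2 2 4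
ψ* 3₄ 2₄ = table 1 3 1 3
ψ* 3₄ 3₄ = table 2 4 2 4

ψ-step : ∀ r b p q → T (q ∨ b) → suc (ψ (next r) b p) ≤ ψ r p q + 2 * bit b
ψ-step = from-yes (∀-Mod4? λ r → ∀-Bool? λ b → ∀-Bool? λ p → ∀-Bool? λ q →
  T? (q ∨ b) →-dec suc (ψ (next r) b p) ≤? ψ r p q + 2 * bit b)

ψ*-mark : ∀ r p q → suc (ψ* 0₄ (next r) true p) ≤ ψ r p q + 2
ψ*-mark = from-yes (∀-Mod4? λ r → ∀-Bool? λ p → ∀-Bool? λ q →
  suc (ψ* 0₄ (next r) true p) ≤? ψ r p q + 2)

ψ*-step : ∀ ra r b p q → T (q ∨ b) → suc (ψ* (next ra) (next r) b p) ≤ ψ* ra r p q + 2 * bit b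
ψ*-step = from-yes (∀-Mod4? λ ra → ∀-Mod4? λ r → ∀-Bool? λ b → ∀-Bool? λ p → ∀-Bool? λ q →
  T? (q ∨ b) →-dec suc (ψ* (next ra) (next r) b p) ≤? ψ* ra r p q + 2 * bit b)

PotentialBound : ∀ {m} → Subset m → ℕ → Set
PotentialBound {m} S φ = m + φ ≤ suc (2 * ∣ S ∣)

prepend-bound : ∀ {m} b (S : Subset m) {φ φ′} → suc φ′ ≤ φ + 2 * bit b
              → PotentialBound S φ → PotentialBound (b ∷ S) φ′
prepend-bound {m} b S {φ} {φ′} step bound = begin
  suc m + φ′                  ≡⟨ +-suc m φ′ ⟨
  m + suc φ′                  ≤⟨ +-monoʳ-≤ m step ⟩
  m + (φ + 2 * bit b)         ≡⟨ +-assoc m φ _ ⟨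
  m + φ + 2 * bit b           ≤⟨ +-monoˡ-≤ _ bound ⟩
  suc (2 * ∣ S ∣ + 2 * bit b) ≡⟨ cong suc (+-comm (2 * ∣ S ∣) _) ⟩
  suc (2 * bit b + 2 * ∣ S ∣) ≡⟨ cong suc (*-distribˡ-+ 2 (bit b) _) ⟨
  suc (2 * (bit b + ∣ S ∣))   ≡⟨ cong (λ s → suc (2 * s)) (∣∷∣ b S) ⟨
  suc (2 * ∣ b ∷ S ∣)         ∎
  where open ≤-Reasoning

dominatesAllButFirst-tail : ∀ {n} b (S : Subset n) → DominatesAllButFirst (b ∷ S) → DominatesAllButFirst S
dominatesAllButFirst-tail b S dom v v<n = dom (suc v) (s≤s v<n)

potential-bound : ∀ {m} (S : Subset m) → DominatesAllButFirst S
                → PotentialBound S (ψ (mod4 m) (S ‼ 0) (S ‼ 1))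
potential-bound [] _ = s≤s z≤n
potential-bound (false ∷ []) _ = s≤s z≤n
potential-bound (true ∷ []) _ = s≤s (s≤s (s≤s z≤n))
potential-bound {suc (suc m)} (b ∷ c ∷ S) dom =
  subst (λ r → PotentialBound (b ∷ c ∷ S) (ψ r b c)) (sym (mod4-suc (suc m)))
    (prepend-bound b (c ∷ S) (ψ-step (mod4 (suc m)) b c (S ‼ 0) (dom 0 (s≤s (s≤s z≤n))))
      (potential-bound (c ∷ S) (dominatesAllButFirst-tail b (c ∷ S) dom)))

marked-potential-bound : ∀ {m} (S : Subset m) a → T (S ‼ a) → DominatesAllButFirst S
                       → PotentialBound S (ψ* (mod4 a) (mod4 m) (S ‼ 0) (S ‼ 1))
marked-potential-bound {suc m} (true ∷ S) zero _ dom =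
  subst (λ r → PotentialBound (true ∷ S) (ψ* 0₄ r true (S ‼ 0))) (sym (mod4-suc m))
    (prepend-bound true S (ψ*-mark (mod4 m) (S ‼ 0) (S ‼ 1))
      (potential-bound S (dominatesAllButFirst-tail true S dom)))
marked-potential-bound {suc (suc m)} (b ∷ c ∷ S) (suc a) a∈S dom =
  subst₂ (λ ra r → PotentialBound (b ∷ c ∷ S) (ψ* ra r b c)) (sym (mod4-suc a)) (sym (mod4-suc (suc m)))
    (prepend-bound b (c ∷ S) (ψ*-step (mod4 a) (mod4 (suc m)) b c (S ‼ 0) (dom 0 (s≤s (s≤s z≤n))))
      (marked-potential-bound (c ∷ S) a a∈S (dominatesAllButFirst-tail b (c ∷ S) dom)))

tds-potential-bound : ∀ {n} (S : Subset n) a → IsTDS n S → a ∈ S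
                    → PotentialBound S (ψ* (mod4 (toℕ a)) (mod4 n) (S ‼ 0) true)
tds-potential-bound {n} S a tds a∈S =
  subst (PotentialBound S ∘ ψ* (mod4 (toℕ a)) (mod4 n) (S ‼ 0)) second∈S
    (marked-potential-bound S (toℕ a) (∈⇒‼ a∈S) (λ v → dom (suc v)))
  where
  dom : TotallyDominating S
  dom = isTDS⇒dominating S tds
  second∈S : S ‼ 1 ≡ true
  second∈S = Equivalence.to T-≡ (subst T (∨-identityʳ (S ‼ 1)) (dom 0 (≤-trans (s≤s z≤n) (toℕ<n a))))

halve : ∀ {x y} → 2 * x ≤ suc (2 * y) → x ≤ y
halve {x} {y} 2x≤2y+1 =
  m<1+n⇒m≤n (*-cancelˡ-< 2 x (suc y) (≤-trans (s≤s 2x≤2y+1) (≤-reflexive (2y+2≡ y))))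
  where
  2y+2≡ : ∀ y → suc (suc (2 * y)) ≡ 2 * suc y
  2y+2≡ = solve-∀

ExcessBelowPotential : ℕ → (Mod4 → ℕ) → Set
ExcessBelowPotential r E = ∀ ra p → 2 * E ra ≤ r + ψ* ra (mod4 r) p true

excessBelowPotential? : ∀ r E → Dec (ExcessBelowPotential r E)
excessBelowPotential? r E = ∀-Mod4? λ ra → ∀-Bool? λ p → 2 * E ra ≤? r + ψ* ra (mod4 r) p true

excess-lower-bound : ∀ {r} (E : Mod4 → ℕ) → ExcessBelowPotential r E
                   → ∀ k (S : Subset (k * 4 + r)) a → IsTDS _ S → a ∈ S
                   → 2 * k + E (mod4 (toℕ a)) ≤ ∣ S ∣
excess-lower-bound {r} E E≤ψ* k S a tds a∈S = halve (begin
  2 * (2 * k + e)                  ≡⟨ distrib k e ⟩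
  k * 4 + 2 * e                    ≤⟨ +-monoʳ-≤ (k * 4) (E≤ψ* ra (S ‼ 0)) ⟩
  k * 4 + (r + φ (mod4 r))         ≡⟨ +-assoc (k * 4) r _ ⟨
  k * 4 + r + φ (mod4 r)           ≡⟨ cong ((k * 4 + r +_) ∘ φ) (mod4-*4+ k r) ⟨
  k * 4 + r + φ (mod4 (k * 4 + r)) ≤⟨ tds-potential-bound S a tds a∈S ⟩
  suc (2 * ∣ S ∣)                  ∎)
  where
  open ≤-Reasoning
  ra : Mod4
  ra = mod4 (toℕ a)
  e : ℕ
  e = E ra
  φ : Mod4 → ℕ
  φ r′ = ψ* ra r′ (S ‼ 0) true
  distrib : ∀ k e → 2 * (2 * k + e) ≡ k * 4 + 2 * e
  distrib = solve-∀

dtd-periodic : ∀ {r} (E : Mod4 → ℕ) → ExcessBelowPotential r E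
             → ∀ k → (∀ a → MTDSThrough (k * 4 + r) a (2 * k + E (mod4 (toℕ a))))
             → ∀ a → IsDtd (k * 4 + r) a (2 * k + E (mod4 (toℕ a)))
dtd-periodic E E≤ψ* k witness a =
  witness a , λ S mtds a∈S → excess-lower-bound E E≤ψ* k S a (proj₁ mtds) a∈S

tabulate-toℕ : ∀ {A : Set} n (f : ℕ → A) → tabulate {n = n} (f ∘ toℕ) ≡ applyUpTo f n
tabulate-toℕ zero f = refl
tabulate-toℕ (suc n) f = cong (f 0 List.∷_) (tabulate-toℕ n (f ∘ suc))

sum-allFin : ∀ n (f : ℕ → ℕ) → sum (map (f ∘ toℕ) (allFin n)) ≡ sum (applyUpTo f n)
sum-allFin n f = cong sum (trans (map-tabulate id (f ∘ toℕ)) (tabulate-toℕ n f))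

sum-periodic : ∀ (g : Mod4 → ℕ) k r
             → sum (applyUpTo (g ∘ mod4) (k * 4 + r))
               ≡ k * (g 0₄ + g 1₄ + g 2₄ + g 3₄) + sum (applyUpTo (g ∘ mod4) r)
sum-periodic g zero r = refl
sum-periodic g (suc k) r = trans (cong (λ s → g 0₄ + (g 1₄ + (g 2₄ + (g 3₄ + s)))) (sum-periodic g k r))
                                 (regroup (g 0₄) (g 1₄) (g 2₄) (g 3₄) k _)
  where
  regroup : ∀ x₀ x₁ x₂ x₃ k s → x₀ + (x₁ + (x₂ + (x₃ + (k * (x₀ + x₁ + x₂ + x₃) + s))))
                               ≡ suc k * (x₀ + x₁ + x₂ + x₃) + s
  regroup = solve-∀

tdi-periodic : ∀ {r} (E : Mod4 → ℕ) → ExcessBelowPotential r E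
             → ∀ k → (∀ a → MTDSThrough (k * 4 + r) a (2 * k + E (mod4 (toℕ a))))
             → let g = λ ra → 2 * k + E ra in
               IsTDI (k * 4 + r) (k * (g 0₄ + g 1₄ + g 2₄ + g 3₄) + sum (applyUpTo (g ∘ mod4) r))
tdi-periodic {r} E E≤ψ* k witness =
  _ , dtd-periodic E E≤ψ* k witness , trans (sum-allFin (k * 4 + r) (g ∘ mod4)) (sum-periodic g k r)
  where
  g : Mod4 → ℕ
  g ra = 2 * k + E ra

E₂ : Mod4 → ℕ
E₂ _ = 2

middle₂ : Mod4 → Subset 6
middle₂ 0₄ = ● ∷ ● ∷ ○ ∷ ○ ∷ ● ∷ ● ∷ []
middle₂ 3₄ = ○ ∷ ● ∷ ● ∷ ● ∷ ● ∷ ○ ∷ []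
middle₂ _ = ○ ∷ ● ∷ ● ∷ ○ ∷ ● ∷ ● ∷ []

witnesses₂ : ∀ k (a : Fin (k * 4 + 2)) → MTDSThrough _ a (2 * k + E₂ (mod4 (toℕ a)))
witnesses₂ zero zero = accepted⇒MTDSThrough refl (● ∷ ● ∷ []) _ zero _ refl
witnesses₂ zero (suc zero) = accepted⇒MTDSThrough refl (● ∷ ● ∷ []) _ (suc zero) _ refl
witnesses₂ (suc k) =
  block-witnesses E₂ middle₂ (from-yes (4 ≤? 6)) (from-yes (goodMiddles? 1 E₂ middle₂)) (suc k) (s≤s z≤n)

tdi₂ : ∀ k → IsTDI (4 * k + 2) (4 * (2 * k + 1) * (k + 1))
tdi₂ k = subst₂ IsTDI (n≡ k) (t≡ k)
  (tdi-periodic E₂ (from-yes (excessBelowPotential? 2 E₂)) k (witnesses₂ k))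
  where
  n≡ : ∀ k → k * 4 + 2 ≡ 4 * k + 2
  n≡ = solve-∀
  t≡ : ∀ k → k * ((2 * k + 2) + (2 * k + 2) + (2 * k + 2) + (2 * k + 2)) + ((2 * k + 2) + ((2 * k + 2) + 0))
           ≡ 4 * (2 * k + 1) * (k + 1)
  t≡ = solve-∀

E₁ : Mod4 → ℕ
E₁ 0₄ = 2
E₁ _ = 1

middle₁ : Mod4 → Subset 5
middle₁ 0₄ = ● ∷ ● ∷ ○ ∷ ● ∷ ● ∷ []
middle₁ _ = ○ ∷ ● ∷ ● ∷ ● ∷ ○ ∷ []

tdi₁ : ∀ k → 0 < k → IsTDI (4 * k + 1) (8 * k * k + 7 * k + 2)
tdi₁ k 0<k = subst₂ IsTDI (n≡ k) (t≡ k) (tdi-periodic E₁ (from-yes (excessBelowPotential? 1 E₁)) k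
  (block-witnesses E₁ middle₁ (from-yes (4 ≤? 5)) (from-yes (goodMiddles? 1 E₁ middle₁)) k 0<k))
  where
  n≡ : ∀ k → k * 4 + 1 ≡ 4 * k + 1
  n≡ = solve-∀
  t≡ : ∀ k → k * ((2 * k + 2) + (2 * k + 1) + (2 * k + 1) + (2 * k + 1)) + ((2 * k + 2) + 0)
           ≡ 8 * k * k + 7 * k + 2
  t≡ = solve-∀

E₃ : Mod4 → ℕ
E₃ 3₄ = 3
E₃ _ = 2

middle₃ : Mod4 → Subset 11
middle₃ 0₄ = ● ∷ ● ∷ ○ ∷ ○ ∷ ● ∷ ● ∷ ○ ∷ ○ ∷ ● ∷ ● ∷ ○ ∷ []
middle₃ 3₄ = ○ ∷ ● ∷ ● ∷ ● ∷ ○ ∷ ○ ∷ ● ∷ ● ∷ ○ ∷ ● ∷ ● ∷ []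
middle₃ _ = ○ ∷ ● ∷ ● ∷ ○ ∷ ○ ∷ ● ∷ ● ∷ ○ ∷ ○ ∷ ● ∷ ● ∷ []

witnesses₃ : ∀ k → k ≢ 1 → (a : Fin (k * 4 + 3)) → MTDSThrough _ a (2 * k + E₃ (mod4 (toℕ a)))
witnesses₃ zero _ zero = accepted⇒MTDSThrough refl (● ∷ ● ∷ ○ ∷ []) _ zero _ refl
witnesses₃ zero _ (suc zero) = accepted⇒MTDSThrough refl (● ∷ ● ∷ ○ ∷ []) _ (suc zero) _ refl
witnesses₃ zero _ (suc (suc zero)) =
  accepted⇒MTDSThrough refl (○ ∷ ● ∷ ● ∷ []) _ (suc (suc zero)) _ refl
witnesses₃ (suc zero) k≢1 = contradiction refl k≢1
witnesses₃ (suc (suc k)) _ =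
  block-witnesses E₃ middle₃ (from-yes (4 ≤? 11)) (from-yes (goodMiddles? 2 E₃ middle₃))
    (suc (suc k)) (s≤s (s≤s z≤n))

tdi₃ : ∀ k → k ≢ 1 → IsTDI (4 * k + 3) (8 * k * k + 15 * k + 6)
tdi₃ k k≢1 = subst₂ IsTDI (n≡ k) (t≡ k)
  (tdi-periodic E₃ (from-yes (excessBelowPotential? 3 E₃)) k (witnesses₃ k k≢1))
  where
  n≡ : ∀ k → k * 4 + 3 ≡ 4 * k + 3
  n≡ = solve-∀
  t≡ : ∀ k → k * ((2 * k + 2) + (2 * k + 2) + (2 * k + 2) + (2 * k + 3))
               + ((2 * k + 2) + ((2 * k + 2) + ((2 * k + 2) + 0)))
           ≡ 8 * k * k + 15 * k + 6
  t≡ = solve-∀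

E₀ : Mod4 → ℕ
E₀ 0₄ = 1
E₀ 3₄ = 1
E₀ _ = 0

middle₀ : Mod4 → Subset 8
middle₀ 0₄ = ● ∷ ● ∷ ○ ∷ ○ ∷ ● ∷ ● ∷ ● ∷ ○ ∷ []
middle₀ 3₄ = ○ ∷ ● ∷ ● ∷ ● ∷ ○ ∷ ○ ∷ ● ∷ ● ∷ []
middle₀ _ = ○ ∷ ● ∷ ● ∷ ○ ∷ ○ ∷ ● ∷ ● ∷ ○ ∷ []

tdi₀ : ∀ k → 1 < k → IsTDI (4 * k) (2 * k * (4 * k + 1))
tdi₀ k 1<k = subst₂ IsTDI (n≡ k) (t≡ k) (tdi-periodic E₀ (from-yes (excessBelowPotential? 0 E₀)) k
  (block-witnesses E₀ middle₀ (from-yes (4 ≤? 8)) (from-yes (goodMiddles? 2 E₀ middle₀)) k 1<k))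
  where
  n≡ : ∀ k → k * 4 + 0 ≡ 4 * k
  n≡ = solve-∀
  t≡ : ∀ k → k * ((2 * k + 1) + (2 * k + 0) + (2 * k + 0) + (2 * k + 1)) + 0 ≡ 2 * k * (4 * k + 1)
  t≡ = solve-∀

theorem15 : ((k : ℕ) → IsTDI (4 * k + 2) (4 * (2 * k + 1) * (k + 1)))
    × ((k : ℕ) → 0 < k → IsTDI (4 * k + 1) (8 * k * k + 7 * k + 2))
    × ((k : ℕ) → k ≢ 1 → IsTDI (4 * k + 3) (8 * k * k + 15 * k + 6))
    × ((k : ℕ) → 1 < k → IsTDI (4 * k) (2 * k * (4 * k + 1)))
theorem15 = tdi₂ , tdi₁ , tdi₃ , tdi₀
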